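{- Let $\mathbf V$ be a commutative unital quantale, let $t\colon\mathbf J_1\to\mathbf J_2$ be a homomorphism of $\mathbf V$-frames $\mathbf J_1=(T_1,r)$, $\mathbf J_2=(T_2,s)$, and let $\mathbf A$ be a $\mathbf V$-module. Then the map $\mathbf A^t\colon A^{T_2}\to A^{T_1}$, $(\mathbf A^t(x))(i)=x(t(i))$, is a lax morphism of $\mathbf V$-F-semilattices $\mathbf A^{\mathbf J_2}\to\mathbf A^{\mathbf J_1}$. Moreover, $\mathbf A^{ - }$ is a contravariant functor from $\mathbf V$-$\mathbb J$ to $\mathbf V$-F-$\mathbb S_\le$.
   Context: A commutative unital quantale $\mathbf V=(V,\bigvee,\otimes,e)$: complete lattice, commutative monoid, $\otimes$ distributing over arbitrary joins. A $\mathbf V$-module $(A,\bigvee,*)$: complete lattice with $*\colon V\times A\to A$ preserving joins in each argument, $u*(v*a)=(u\otimes v)*a$, $e*a=a$; module homomorphisms preserve arbitrary joins and the action. A $\mathbf V$-frame is $(T,r)$ with $r\colon T\times T\to V$; a frame homomorphism $t\colon(T_1,r)\to(T_2,s)$ is a map with $r(i,j)\le s(t(i),t(j))$; $\mathbf V$-$\mathbb J$ is the category of frames. A $\mathbf V$-F-semilattice is $(\mathbf A,F)$ with $F$ a module endomorphism; a lax morphism $g\colon(\mathbf A_1,F_1)\to(\mathbf A_2,F_2)$ is a module homomorphism with $F_2(g(a))\le g(F_1(a))$; $\mathbf V$-F-$\mathbb S_\le$ is this category. $\mathbf A^{\mathbf J}=(\mathbf A^T,F^{\mathbf J})$ with pointwise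 module structure on $A^T$ and $(F^{\mathbf J}(x))(i)=\bigvee_{k\in T}r(i,k)*x(k)$. -}

module Defs where

open import Level using (0ℓ)
open import Data.Product using (_×_; _,_)
open import Function using (_∘_)
open import Relation.Binary.Core using (Rel)
open import Relation.Binary.Structures using (IsPartialOrder)
open import Algebra.Core using (Op₂)
open import Algebra.Structures using (IsCommutativeMonoid)

record RawCL : Set₁ where
  field
    Carrier : Set
    _≈_     : Rel Carrier 0ℓ
    _≤_     : Rel Carrier 0ℓ
    ⋁       : {I : Set} → (I → Carrier) → Carrier

record IsCL (L : RawCL) : Set₁ where
  open RawCL L
  field
    isPartialOrder : IsPartialOrder _≈_ _≤_
    ⋁-upper : ∀ {I : Set} (f : I → Carrier) (i : I) → f i ≤ ⋁ f
    ⋁-least : ∀ {I : Set} (f : I → Carrier) (b : Carrier) →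
              (∀ i → f i ≤ b) → ⋁ f ≤ b

record Quantale : Set₁ where
  field
    lattice : RawCL
    isCL    : IsCL lattice
  open RawCL lattice public
  field
    _⊗_ : Op₂ Carrier
    e   : Carrier
    isCommutativeMonoid : IsCommutativeMonoid _≈_ _⊗_ e
    ⊗-distribˡ-⋁ : ∀ {I : Set} (a : Carrier) (f : I → Carrier) →
                   (a ⊗ ⋁ f) ≈ ⋁ (λ i → a ⊗ f i)
    ⊗-distribʳ-⋁ : ∀ {I : Set} (f : I → Carrier) (a : Carrier) →
                   (⋁ f ⊗ a) ≈ ⋁ (λ i → f i ⊗ a)

module _ (V : Quantale) where
  private module V = Quantale V

  record RawModule : Set₁ where
    field
      lattice : RawCL
    open RawCL lattice public
    field
      _*_ : V.Carrier → Carrier → Carrier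

  record IsModule (M : RawModule) : Set₁ where
    open RawModule M
    field
      isCL   : IsCL lattice
      *-cong : ∀ {u u' a a'} → u V.≈ u' → a ≈ a' → (u * a) ≈ (u' * a')
      *-⋁ˡ   : ∀ {I : Set} (f : I → V.Carrier) (a : Carrier) →
               (V.⋁ f * a) ≈ ⋁ (λ i → f i * a)
      *-⋁ʳ   : ∀ {I : Set} (u : V.Carrier) (g : I → Carrier) →
               (u * ⋁ g) ≈ ⋁ (λ i → u * g i)
      *-assoc : ∀ u v a → (u * (v * a)) ≈ ((u V.⊗ v) * a)
      *-identity : ∀ a → (V.e * a) ≈ a

  record IsModuleHom (M N : RawModule)
           (g : RawModule.Carrier M → RawModule.Carrier N) : Set₁ where
    private
      module M = RawModule M
      module N = RawModule N
    field
      cong     : ∀ {a b} → a M.≈ b → g a N.≈ g b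
      pres-⋁   : ∀ {I : Set} (f : I → M.Carrier) → g (M.⋁ f) N.≈ N.⋁ (g ∘ f)
      pres-*   : ∀ u a → g (u M.* a) N.≈ (u N.* g a)

  record RawFSemilattice : Set₁ where
    field
      module' : RawModule
    open RawModule module' public
    field
      F : Carrier → Carrier

  IsFSemilattice : RawFSemilattice → Set₁
  IsFSemilattice X =
    IsModule (RawFSemilattice.module' X) ×
    IsModuleHom (RawFSemilattice.module' X) (RawFSemilattice.module' X)
                (RawFSemilattice.F X)

  IsLaxMorphism : (X Y : RawFSemilattice) →
                  (RawFSemilattice.Carrier X → RawFSemilattice.Carrier Y) → Set₁
  IsLaxMorphism X Y g =
    IsModuleHom (RawFSemilattice.module' X) (RawFSemilattice.module' Y) g ×
    (∀ a → RawFSemilattice._≤_ Y (RawFSemilattice.F Y (g a))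
                                 (g (RawFSemilattice.F X a)))

  record Frame : Set₁ where
    field
      T : Set
      r : T → T → V.Carrier

  IsFrameHom : (J₁ J₂ : Frame) → (Frame.T J₁ → Frame.T J₂) → Set
  IsFrameHom J₁ J₂ t = ∀ i j → Frame.r J₁ i j V.≤ Frame.r J₂ (t i) (t j)

  _^_ : RawModule → Set → RawModule
  A ^ T = record
    { lattice = record
        { Carrier = T → A.Carrier
        ; _≈_ = λ x y → ∀ k → x k A.≈ y k
        ; _≤_ = λ x y → ∀ k → x k A.≤ y k
        ; ⋁   = λ f k → A.⋁ (λ i → f i k)
        }
    ; _*_ = λ u x k → u A.* x k
    }
    where module A = RawModule A

  _^F_ : RawModule → Frame → RawFSemilattice
  A ^F J = record
    { module' = A ^ Frame.T J
    ; F = λ x i → RawModule.⋁ A {Frame.T J}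
                    (λ k → RawModule._*_ A (Frame.r J i k) (x k))
    }

  pow-map : (A : RawModule) {T₁ T₂ : Set} → (T₁ → T₂) →
            (T₂ → RawModule.Carrier A) → (T₁ → RawModule.Carrier A)
  pow-map A t x = x ∘ t

-- A^J inherits every module law pointwise, and F^J is a module endomorphism because
-- the action distributes over joins and the two scalars in r(i,k) * (u * x k) can be
-- swapped by commutativity of ⊗. For a frame homomorphism t, precomposition with t is
-- trivially a module homomorphism; laxness holds because r(i,k) ≤ s(t i, t k) and the
-- action is monotone, so each term of (F^{J₁}(x ∘ t))(i) is bounded by the (t k)-th term
-- of (F^{J₂} x)(t i). Functoriality holds definitionally.
module Submission where

open import Defs
open import Data.Product using (_×_; _,_)
open import Data.Bool using (true; false; if_then_else_)
open import Function using (_∘_; id)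
open import Relation.Binary.Structures using (IsPartialOrder)
open import Algebra.Structures using (IsCommutativeMonoid)

module CompleteLatticeProperties (L : RawCL) (isCL : IsCL L) where
  open RawCL L
  open IsCL isCL public
  open IsPartialOrder isPartialOrder public

  ⋁-mono-reindex : ∀ {I J : Set} (f : I → Carrier) (g : J → Carrier) (t : I → J) →
                   (∀ i → f i ≤ g (t i)) → ⋁ f ≤ ⋁ g
  ⋁-mono-reindex f g t f≤g∘t = ⋁-least f (⋁ g) (λ i → trans (f≤g∘t i) (⋁-upper g (t i)))

  ⋁-mono : ∀ {I : Set} (f g : I → Carrier) → (∀ i → f i ≤ g i) → ⋁ f ≤ ⋁ g
  ⋁-mono f g = ⋁-mono-reindex f g id

  ⋁-cong : ∀ {I : Set} (f g : I → Carrier) → (∀ i → f i ≈ g i) → ⋁ f ≈ ⋁ g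
  ⋁-cong f g f≈g =
    antisym (⋁-mono f g (λ i → reflexive (f≈g i)))
            (⋁-mono g f (λ i → reflexive (Eq.sym (f≈g i))))

  ⋁-comm : ∀ {I J : Set} (f : I → J → Carrier) →
           ⋁ (λ i → ⋁ (λ j → f i j)) ≈ ⋁ (λ j → ⋁ (λ i → f i j))
  ⋁-comm f = antisym (swap f) (swap (λ j i → f i j))
    where
    swap : ∀ {I J : Set} (g : I → J → Carrier) →
           ⋁ (λ i → ⋁ (λ j → g i j)) ≤ ⋁ (λ j → ⋁ (λ i → g i j))
    swap g = ⋁-least _ _ λ i → ⋁-least _ _ λ j →
      trans (⋁-upper (λ i' → g i' j) i) (⋁-upper (λ j' → ⋁ (λ i' → g i' j')) j)

  ⋁-pair-≤ : ∀ {u v} → u ≤ v → ⋁ (λ b → if b then u else v) ≈ v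
  ⋁-pair-≤ {u} {v} u≤v =
    antisym (⋁-least _ _ λ { true → u≤v ; false → refl })
            (⋁-upper (λ b → if b then u else v) false)

module ModuleProperties (V : Quantale) (A : RawModule V) (isModule : IsModule V A) where
  private
    module V where
      open Quantale V public
      open CompleteLatticeProperties lattice isCL public
      open IsCommutativeMonoid isCommutativeMonoid public using (comm)
  open RawModule A
  open IsModule isModule
  open CompleteLatticeProperties lattice isCL

  -- The action preserves the join of the two-element family {u, v}, which is v when u ≤ v.
  *-monoˡ : ∀ {u v} a → u V.≤ v → (u * a) ≤ (v * a)
  *-monoˡ {u} {v} a u≤v =
    trans (⋁-upper (λ b → (if b then u else v) * a) true)
          (reflexive (Eq.trans (Eq.sym (*-⋁ˡ (λ b → if b then u else v) a))
                               (*-cong (V.⋁-pair-≤ u≤v) Eq.refl)))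

  *-exchange : ∀ u v a → (u * (v * a)) ≈ (v * (u * a))
  *-exchange u v a =
    Eq.trans (*-assoc u v a)
      (Eq.trans (*-cong (V.comm u v) Eq.refl) (Eq.sym (*-assoc v u a)))

  ^-isModule : (T : Set) → IsModule V (_^_ V A T)
  ^-isModule T = record
    { isCL = record
      { isPartialOrder = record
        { isPreorder = record
          { isEquivalence = record
            { refl = λ k → Eq.refl
            ; sym = λ x≈y k → Eq.sym (x≈y k)
            ; trans = λ x≈y y≈z k → Eq.trans (x≈y k) (y≈z k) }
          ; reflexive = λ x≈y k → reflexive (x≈y k)
          ; trans = λ x≤y y≤z k → trans (x≤y k) (y≤z k) }
        ; antisym = λ x≤y y≤x k → antisym (x≤y k) (y≤x k) }
      ; ⋁-upper = λ f i k → ⋁-upper (λ j → f j k) i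
      ; ⋁-least = λ f b f≤b k → ⋁-least (λ j → f j k) (b k) (λ i → f≤b i k) }
    ; *-cong = λ u≈v x≈y k → *-cong u≈v (x≈y k)
    ; *-⋁ˡ = λ f x k → *-⋁ˡ f (x k)
    ; *-⋁ʳ = λ u g k → *-⋁ʳ u (λ i → g i k)
    ; *-assoc = λ u v x k → *-assoc u v (x k)
    ; *-identity = λ x k → *-identity (x k) }

  ^F-isFSemilattice : (J : Frame V) → IsFSemilattice V (_^F_ V A J)
  ^F-isFSemilattice J = ^-isModule T , record
    { cong = λ x≈y i → ⋁-cong _ _ (λ k → *-cong V.Eq.refl (x≈y k))
    ; pres-⋁ = λ f i →
        Eq.trans (⋁-cong _ _ (λ k → *-⋁ʳ (r i k) (λ j → f j k)))
                 (⋁-comm (λ k j → r i k * f j k))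
    ; pres-* = λ u x i →
        Eq.trans (⋁-cong _ _ (λ k → *-exchange (r i k) u (x k)))
                 (Eq.sym (*-⋁ʳ u (λ k → r i k * x k)))
    }
    where open Frame J

  pow-map-isModuleHom : {T₁ T₂ : Set} (t : T₁ → T₂) →
                        IsModuleHom V (_^_ V A T₂) (_^_ V A T₁) (pow-map V A t)
  pow-map-isModuleHom t = record
    { cong = λ x≈y i → x≈y (t i)
    ; pres-⋁ = λ f i → Eq.refl
    ; pres-* = λ u x i → Eq.refl
    }

  pow-map-isLaxMorphism : (J₁ J₂ : Frame V) (t : Frame.T J₁ → Frame.T J₂) →
                          IsFrameHom V J₁ J₂ t →
                          IsLaxMorphism V (_^F_ V A J₂) (_^F_ V A J₁) (pow-map V A t)
  pow-map-isLaxMorphism J₁ J₂ t t-hom =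
    pow-map-isModuleHom t ,
    λ x i → ⋁-mono-reindex _ (λ k → Frame.r J₂ (t i) k * x k) t
                           (λ k → *-monoˡ (x (t k)) (t-hom i k))

mainTheorem5 :
    (V : Quantale) (A : RawModule V) → IsModule V A →
      ((J : Frame V) → IsFSemilattice V (_^F_ V A J))
      × ((J₁ J₂ : Frame V) (t : Frame.T J₁ → Frame.T J₂) → IsFrameHom V J₁ J₂ t →
           IsLaxMorphism V (_^F_ V A J₂) (_^F_ V A J₁) (pow-map V A t))
      × ((J : Frame V) (x : Frame.T J → RawModule.Carrier A) →
           RawModule._≈_ (_^_ V A (Frame.T J)) (pow-map V A id x) x)
      × ((J₁ J₂ J₃ : Frame V) (t : Frame.T J₁ → Frame.T J₂) (u : Frame.T J₂ → Frame.T J₃) →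
           IsFrameHom V J₁ J₂ t → IsFrameHom V J₂ J₃ u →
           (x : Frame.T J₃ → RawModule.Carrier A) →
           RawModule._≈_ (_^_ V A (Frame.T J₁))
             (pow-map V A (u ∘ t) x) (pow-map V A t (pow-map V A u x)))
mainTheorem5 V A isModule =
    ^F-isFSemilattice
  , pow-map-isLaxMorphism
  , (λ J x k → Eq.refl)
  , (λ J₁ J₂ J₃ t u t-hom u-hom x k → Eq.refl)
  where
  open ModuleProperties V A isModule
  open IsPartialOrder (IsCL.isPartialOrder (IsModule.isCL isModule)) using (module Eq)
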